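{- Let $G$ be a graph of order $n\ge 5$ with stability number $\alpha$ and Fibonacci index $F$. Then \[ F\le\frac{2^n-n-1}{n-1}(\alpha-1)+n+1, \] with equality if and only if $G\simeq K_n$ or $G\simeq\overline{K_n}$.
   Context: Graphs are finite, simple, undirected. The Fibonacci index $F(G)$ is the number of stable sets of $G$ including the empty set; the stability number is the maximum size of a stable set. $K_n$ is the complete graph on $n$ vertices and $\overline{K_n}$ the edgeless graph on $n$ vertices. -}

module Defs where

open import Data.Nat using (ℕ; zero; suc; _+_; _*_; _∸_; _^_; _≤_; _⊔_)
open import Data.Bool using (Bool; true; false; _∧_; not)
open import Data.Fin using (Fin)
open import Data.Fin.Subset using (Subset; _∈_; ∣_∣; inside; outside)
open import Data.Vec using (Vec; []; _∷_)
open import Data.List using (List; []; _∷_; map; _++_; filter; length; foldr; allFin)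
open import Data.List.Relation.Unary.All using (All)
open import Relation.Binary.PropositionalEquality using (_≡_)
open import Function.Bundles using (_↔_; Inverse)

record Graph (n : ℕ) : Set where
  field
    adj   : Fin n → Fin n → Bool
    adj-sym : ∀ u v → adj u v ≡ adj v u
    adj-irrefl : ∀ v → adj v v ≡ false
open Graph public

allSubsets : (n : ℕ) → List (Subset n)
allSubsets zero = [] ∷ []
allSubsets (suc n) = map (outside ∷_) (allSubsets n) ++ map (inside ∷_) (allSubsets n)

_∈ᵇ_ : ∀ {n} → Fin n → Subset n → Bool
i ∈ᵇ S = Data.Vec.lookup S i

allB : ∀ {n} → (Fin n → Bool) → Bool
allB {n} p = foldr (λ i b → p i ∧ b) true (allFin n)

isStable : ∀ {n} → Graph n → Subset n → Bool
isStable G S = allB (λ u → allB (λ v → not (u ∈ᵇ S ∧ v ∈ᵇ S ∧ adj G u v)))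

stableSets : ∀ {n} → Graph n → List (Subset n)
stableSets {n} G = filter (λ S → Data.Bool._≟_ (isStable G S) true) (allSubsets n)

fibonacciIndex : ∀ {n} → Graph n → ℕ
fibonacciIndex G = length (stableSets G)

stabilityNumber : ∀ {n} → Graph n → ℕ
stabilityNumber G = foldr (λ S m → ∣ S ∣ ⊔ m) 0 (stableSets G)

_≃G_ : ∀ {n m} → Graph n → Graph m → Set
_≃G_ {n} {m} G H = Data.Product.Σ (Fin n ↔ Fin m) λ f →
  ∀ u v → adj G u v ≡ adj H (Inverse.to f u) (Inverse.to f v)
  where import Data.Product

open import Data.Fin using (_≟_)
open import Relation.Nullary using (yes; no)
open import Relation.Binary.PropositionalEquality using (refl)

completeAdj : ∀ {n} → Fin n → Fin n → Bool
completeAdj u v with u ≟ v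
... | yes _ = false
... | no _ = true

K : (n : ℕ) → Graph n
K n = record { adj = completeAdj ; adj-sym = s ; adj-irrefl = r }
  where
  open import Relation.Binary.PropositionalEquality using (sym)
  s : ∀ u v → completeAdj u v ≡ completeAdj v u
  s u v with u ≟ v | v ≟ u
  ... | yes _ | yes _ = refl
  ... | no _ | no _ = refl
  ... | yes p | no q = Data.Empty.⊥-elim (q (sym p)) where import Data.Empty
  ... | no p | yes q = Data.Empty.⊥-elim (p (sym q)) where import Data.Empty
  r : ∀ v → completeAdj v v ≡ false
  r v with v ≟ v
  ... | yes _ = refl
  ... | no p = Data.Empty.⊥-elim (p refl) where import Data.Empty

Kbar : (n : ℕ) → Graph n
Kbar n = record { adj = λ _ _ → false ; adj-sym = λ _ _ → refl ; adj-irrefl = λ _ → refl }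

module Submission where

-- Fix a maximum stable set S, |S| = α.  Every stable set is A ∪ B with A ⊆ S
-- and B ⊆ ∁ S stable.  For such B, A lies in the set X of vertices of S with
-- no neighbour in B, and X ∪ B is stable, so B has at most 2^(α − |B|)
-- extensions; summing over B gives F ≤ Σ_k C(n − α, k) 2^(α − k), one less if
-- ∁ S contains an edge (module CountingBound).  For 2 ≤ α < n this is below
-- the claimed bound (strict-bound): for n ≥ 10 via F ≤ 2^α (3/2)^(n − α) and
-- (a + r)·3^r < a·4^r, for 5 ≤ n ≤ 9 by a finite check.  The remaining
-- values α = 1 and α = n force G ≅ K_n and G ≅ complement of K_n, which
-- attain the bound (extremal-equality).

open import Defs
open import Data.Nat using (ℕ; zero; suc; _+_; _*_; _∸_; _^_; _≤_; _<_; _⊔_; z≤n; s≤s; _≤?_; _≤ᵇ_; _<ᵇ_)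
open import Data.Nat.Properties
open import Data.Bool using (Bool; true; false; _∧_; _∨_; not; T)
open import Data.Bool.Properties using (¬-not; not-involutive; T-∧)
open import Data.Fin using (Fin; zero; suc)
import Data.Fin
import Data.Nat
open import Data.Fin.Properties using (¬∀⟶∃¬)
open import Data.Fin.Subset using (Subset; _∈_; _∉_; _⊆_; _∪_; ∁; ⊤; ⊥; ⁅_⁆; ∣_∣; inside; outside)
open import Data.Fin.Subset.Properties
  using (∉⊥; ∈⊤; ∣⊥∣≡0; ∣⊤∣≡n; ∣p∣≤n; ∣p∣≡n⇒p≡⊤; Empty-unique; nonempty?; p⊆q⇒∣p∣≤∣q∣; out⊆; in⊆in; drop-∷-⊆; ∣⁅x⁆∣≡1; x∈⁅x⁆; x∈⁅y⁆⇒x≡y; x∈p∪q⁺; x∈p∪q⁻; ∣p∣≤∣p∪q∣; p⊆p∪q; q⊆p∪q; x∈∁p⇒x∉p; ∣∁p∣≡n∸∣p∣)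
open import Data.Vec using ([]; _∷_; lookup; tabulate; here; there)
open import Data.Vec.Properties using ([]=⇒lookup; lookup⇒[]=; lookup∘tabulate)
open import Data.List using (List; []; _∷_; _++_; map; filter; length; foldr; allFin)
open import Data.List.Properties using (map-++; map-∘)
open import Data.Nat.ListAction using (sum)
open import Data.Nat.ListAction.Properties using (sum-++)
import Data.List.Relation.Unary.Any as Any
open import Data.List.Membership.Propositional.Properties
  using (∈-allFin; ∈-filter⁺; ∈-filter⁻; ∈-++⁺ˡ; ∈-++⁺ʳ; ∈-map⁺)
import Data.List.Membership.Propositional as List
open import Data.Product using (∃-syntax; _×_; _,_; proj₁; proj₂; map₂)
open import Data.Sum using (_⊎_; inj₁; inj₂)
open import Data.Empty using (⊥-elim)
open import Relation.Nullary using (¬_; Dec; yes; no)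
open import Relation.Binary.PropositionalEquality
open import Function.Base using (_∘_)
open import Function.Bundles using (Inverse; Equivalence; _⇔_; mk⇔)
open import Function.Construct.Identity using (↔-id)
open import Data.Nat.Tactic.RingSolver using (solve-∀)
open import Algebra.Properties.CommutativeSemigroup +-commutativeSemigroup using (interchange)

module _ {n : ℕ} (p : Fin n → Bool) where

  foldr-∧⁻ : ∀ xs → foldr (λ i b → p i ∧ b) true xs ≡ true → ∀ {i} → i List.∈ xs → p i ≡ true
  foldr-∧⁻ (x ∷ xs) e i∈ with p x in px
  foldr-∧⁻ (x ∷ xs) e (Any.here refl) | true = px
  foldr-∧⁻ (x ∷ xs) e (Any.there i∈) | true = foldr-∧⁻ xs e i∈

  foldr-∧⁺ : ∀ xs → (∀ {i} → i List.∈ xs → p i ≡ true) → foldr (λ i b → p i ∧ b) true xs ≡ true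
  foldr-∧⁺ [] h = refl
  foldr-∧⁺ (x ∷ xs) h rewrite h (Any.here refl) = foldr-∧⁺ xs (λ i∈ → h (Any.there i∈))

  allB⁻ : allB p ≡ true → ∀ i → p i ≡ true
  allB⁻ e i = foldr-∧⁻ (allFin n) e (∈-allFin i)

  allB⁺ : (∀ i → p i ≡ true) → allB p ≡ true
  allB⁺ h = foldr-∧⁺ (allFin n) (λ {i} _ → h i)

  allB-false : allB p ≡ false → ∃[ i ] p i ≡ false
  allB-false e = map₂ ¬-not (¬∀⟶∃¬ n (λ i → p i ≡ true) (λ i → p i Data.Bool.≟ true) not-all)
    where
    not-all : ¬ (∀ i → p i ≡ true)
    not-all h with trans (sym (allB⁺ h)) e
    ... | ()

module _ {n : ℕ} (G : Graph n) where

  Stable : Subset n → Set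
  Stable T = ∀ {u v} → u ∈ T → v ∈ T → adj G u v ≡ false

  HasEdge : Subset n → Set
  HasEdge T = ∃[ u ] ∃[ v ] u ∈ T × v ∈ T × adj G u v ≡ true

  isStable⇒Stable : ∀ T → isStable G T ≡ true → Stable T
  isStable⇒Stable T e {u} {v} u∈T v∈T = no-edge (allB⁻ _ (allB⁻ _ e u) v)
    where
    no-edge : not (lookup T u ∧ lookup T v ∧ adj G u v) ≡ true → adj G u v ≡ false
    no-edge h rewrite []=⇒lookup u∈T | []=⇒lookup v∈T = trans (sym (not-involutive _)) (cong not h)

  Stable⇒isStable : ∀ T → Stable T → isStable G T ≡ true
  Stable⇒isStable T st = allB⁺ _ (λ u → allB⁺ _ (λ v → no-edge u v))
    where
    no-edge : ∀ u v → not (lookup T u ∧ lookup T v ∧ adj G u v) ≡ true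
    no-edge u v with lookup T u in eu | lookup T v in ev
    ... | false | _ = refl
    ... | true | false = refl
    ... | true | true rewrite st (lookup⇒[]= u T eu) (lookup⇒[]= v T ev) = refl

  isStable-false⇒HasEdge : ∀ T → isStable G T ≡ false → HasEdge T
  isStable-false⇒HasEdge T e with allB-false _ e
  ... | u , eu with allB-false _ eu
  ...   | v , ev = u , v , edge ev
    where
    edge : not (lookup T u ∧ lookup T v ∧ adj G u v) ≡ false → u ∈ T × v ∈ T × adj G u v ≡ true
    edge h with lookup T u in lu | lookup T v in lv | adj G u v
    ... | true | true | true = lookup⇒[]= u T lu , lookup⇒[]= v T lv , refl

  ¬Stable⇒isStable-false : ∀ T → ¬ Stable T → isStable G T ≡ false
  ¬Stable⇒isStable-false T unstable = ¬-not (λ e → unstable (isStable⇒Stable T e))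

  HasEdge⇒¬Stable : ∀ {T} → HasEdge T → ¬ Stable T
  HasEdge⇒¬Stable (u , v , u∈T , v∈T , e) st with trans (sym e) (st u∈T v∈T)
  ... | ()

  Stable-⊥ : Stable ⊥
  Stable-⊥ u∈⊥ = ⊥-elim (∉⊥ u∈⊥)

  Stable-⊆ : ∀ {T T′} → T ⊆ T′ → Stable T′ → Stable T
  Stable-⊆ T⊆T′ st u∈T v∈T = st (T⊆T′ u∈T) (T⊆T′ v∈T)

  Stable-pair : ∀ {u v} → adj G u v ≡ false → Stable (⁅ u ⁆ ∪ ⁅ v ⁆)
  Stable-pair {u} {v} e {w} {w′} w∈ w′∈ with x∈p∪q⁻ ⁅ u ⁆ ⁅ v ⁆ w∈ | x∈p∪q⁻ ⁅ u ⁆ ⁅ v ⁆ w′∈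
  ... | inj₁ w∈u | inj₁ w′∈u rewrite x∈⁅y⁆⇒x≡y u w∈u | x∈⁅y⁆⇒x≡y u w′∈u = adj-irrefl G u
  ... | inj₂ w∈v | inj₂ w′∈v rewrite x∈⁅y⁆⇒x≡y v w∈v | x∈⁅y⁆⇒x≡y v w′∈v = adj-irrefl G v
  ... | inj₁ w∈u | inj₂ w′∈v rewrite x∈⁅y⁆⇒x≡y u w∈u | x∈⁅y⁆⇒x≡y v w′∈v = e
  ... | inj₂ w∈v | inj₁ w′∈u rewrite x∈⁅y⁆⇒x≡y v w∈v | x∈⁅y⁆⇒x≡y u w′∈u = trans (adj-sym G v u) e

∣∪∣-disjoint : ∀ {n} (A B : Subset n) → (∀ {x} → x ∈ A → x ∉ B) → ∣ A ∪ B ∣ ≡ ∣ A ∣ + ∣ B ∣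
∣∪∣-disjoint [] [] _ = refl
∣∪∣-disjoint (inside ∷ A) (inside ∷ B) disj = ⊥-elim (disj here here)
∣∪∣-disjoint (inside ∷ A) (outside ∷ B) disj = cong suc (∣∪∣-disjoint A B (λ x∈A x∈B → disj (there x∈A) (there x∈B)))
∣∪∣-disjoint (outside ∷ A) (inside ∷ B) disj =
  trans (cong suc (∣∪∣-disjoint A B (λ x∈A x∈B → disj (there x∈A) (there x∈B)))) (sym (+-suc ∣ A ∣ ∣ B ∣))
∣∪∣-disjoint (outside ∷ A) (outside ∷ B) disj = ∣∪∣-disjoint A B (λ x∈A x∈B → disj (there x∈A) (there x∈B))

∣pair∣ : ∀ {n} {u v : Fin n} → u ≢ v → ∣ ⁅ u ⁆ ∪ ⁅ v ⁆ ∣ ≡ 2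
∣pair∣ {u = u} {v} u≢v = begin
  ∣ ⁅ u ⁆ ∪ ⁅ v ⁆ ∣     ≡⟨ ∣∪∣-disjoint ⁅ u ⁆ ⁅ v ⁆ disjoint ⟩
  ∣ ⁅ u ⁆ ∣ + ∣ ⁅ v ⁆ ∣ ≡⟨ cong₂ _+_ (∣⁅x⁆∣≡1 u) (∣⁅x⁆∣≡1 v) ⟩
  2 ∎
  where
  open ≡-Reasoning
  disjoint : ∀ {x} → x ∈ ⁅ u ⁆ → x ∉ ⁅ v ⁆
  disjoint x∈u x∈v = u≢v (trans (sym (x∈⁅y⁆⇒x≡y u x∈u)) (x∈⁅y⁆⇒x≡y v x∈v))

pair⊆ : ∀ {n} {u v : Fin n} {T : Subset n} → u ∈ T → v ∈ T → ⁅ u ⁆ ∪ ⁅ v ⁆ ⊆ T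
pair⊆ {u = u} {v} u∈T v∈T x∈ with x∈p∪q⁻ ⁅ u ⁆ ⁅ v ⁆ x∈
... | inj₁ x∈u rewrite x∈⁅y⁆⇒x≡y u x∈u = u∈T
... | inj₂ x∈v rewrite x∈⁅y⁆⇒x≡y v x∈v = v∈T

∣∣≤1⇒≡ : ∀ {n} {T : Subset n} {u v} → ∣ T ∣ ≤ 1 → u ∈ T → v ∈ T → u ≡ v
∣∣≤1⇒≡ {T = T} {u = u} {v} small u∈T v∈T with u Data.Fin.≟ v
... | yes u≡v = u≡v
... | no u≢v = ⊥-elim (<-irrefl refl (begin-strict
  1                  <⟨ ≤-reflexive (sym (∣pair∣ u≢v)) ⟩
  ∣ ⁅ u ⁆ ∪ ⁅ v ⁆ ∣  ≤⟨ p⊆q⇒∣p∣≤∣q∣ (pair⊆ u∈T v∈T) ⟩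
  ∣ T ∣              ≤⟨ small ⟩
  1 ∎))
  where open ≤-Reasoning

ind : Bool → ℕ
ind true = 1
ind false = 0

Σ⊆ : ∀ {n} → Subset n → (Subset n → ℕ) → ℕ
Σ⊆ [] f = f []
Σ⊆ (outside ∷ X) f = Σ⊆ X (λ A → f (outside ∷ A))
Σ⊆ (inside ∷ X) f = Σ⊆ X (λ A → f (outside ∷ A)) + Σ⊆ X (λ A → f (inside ∷ A))

Σ⊆-mono : ∀ {n} (X : Subset n) {f g} → (∀ A → A ⊆ X → f A ≤ g A) → Σ⊆ X f ≤ Σ⊆ X g
Σ⊆-mono [] h = h [] (λ ())
Σ⊆-mono (outside ∷ X) h = Σ⊆-mono X (λ A A⊆X → h _ (out⊆ A⊆X))
Σ⊆-mono (inside ∷ X) h =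
  +-mono-≤ (Σ⊆-mono X (λ A A⊆X → h _ (out⊆ A⊆X))) (Σ⊆-mono X (λ A A⊆X → h _ (in⊆in A⊆X)))

Σ⊆-cong : ∀ {n} (X : Subset n) {f g} → (∀ A → A ⊆ X → f A ≡ g A) → Σ⊆ X f ≡ Σ⊆ X g
Σ⊆-cong X h = ≤-antisym (Σ⊆-mono X (λ A A⊆X → ≤-reflexive (h A A⊆X)))
                        (Σ⊆-mono X (λ A A⊆X → ≤-reflexive (sym (h A A⊆X))))

Σ⊆-strict : ∀ {n} (X : Subset n) {f g} → (∀ A → A ⊆ X → f A ≤ g A) →
            ∀ A₀ → A₀ ⊆ X → f A₀ < g A₀ → Σ⊆ X f < Σ⊆ X g
Σ⊆-strict [] h [] _ lt = lt
Σ⊆-strict (outside ∷ X) h (outside ∷ A₀) A₀⊆X lt =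
  Σ⊆-strict X (λ A A⊆X → h _ (out⊆ A⊆X)) A₀ (drop-∷-⊆ A₀⊆X) lt
Σ⊆-strict (outside ∷ X) h (inside ∷ A₀) A₀⊆X lt with A₀⊆X here
... | ()
Σ⊆-strict (inside ∷ X) h (outside ∷ A₀) A₀⊆X lt =
  +-mono-<-≤ (Σ⊆-strict X (λ A A⊆X → h _ (out⊆ A⊆X)) A₀ (drop-∷-⊆ A₀⊆X) lt)
             (Σ⊆-mono X (λ A A⊆X → h _ (in⊆in A⊆X)))
Σ⊆-strict (inside ∷ X) h (inside ∷ A₀) A₀⊆X lt =
  +-mono-≤-< (Σ⊆-mono X (λ A A⊆X → h _ (out⊆ A⊆X)))
             (Σ⊆-strict X (λ A A⊆X → h _ (in⊆in A⊆X)) A₀ (drop-∷-⊆ A₀⊆X) lt)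

Σ⊆-zero : ∀ {n} (X : Subset n) {f} → (∀ A → A ⊆ X → f A ≡ 0) → Σ⊆ X f ≡ 0
Σ⊆-zero [] h = h [] (λ ())
Σ⊆-zero (outside ∷ X) h = Σ⊆-zero X (λ A A⊆X → h _ (out⊆ A⊆X))
Σ⊆-zero (inside ∷ X) h =
  cong₂ _+_ (Σ⊆-zero X (λ A A⊆X → h _ (out⊆ A⊆X))) (Σ⊆-zero X (λ A A⊆X → h _ (in⊆in A⊆X)))

Σ⊆-+ : ∀ {n} (X : Subset n) (f g : Subset n → ℕ) → Σ⊆ X (λ A → f A + g A) ≡ Σ⊆ X f + Σ⊆ X g
Σ⊆-+ [] f g = refl
Σ⊆-+ (outside ∷ X) f g = Σ⊆-+ X _ _
Σ⊆-+ (inside ∷ X) f g =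
  trans (cong₂ _+_ (Σ⊆-+ X _ _) (Σ⊆-+ X _ _)) (interchange (Σ⊆ X _) (Σ⊆ X _) (Σ⊆ X _) (Σ⊆ X _))

-- Every T ⊆ Fin n splits uniquely as A ∪ B with A ⊆ S and B ⊆ ∁ S.
Σ⊆-split : ∀ {n} (S : Subset n) (f : Subset n → ℕ) →
           Σ⊆ ⊤ f ≡ Σ⊆ (∁ S) (λ B → Σ⊆ S (λ A → f (A ∪ B)))
Σ⊆-split [] f = refl
Σ⊆-split (outside ∷ S) f = cong₂ _+_ (Σ⊆-split S _) (Σ⊆-split S _)
Σ⊆-split (inside ∷ S) f =
  trans (cong₂ _+_ (Σ⊆-split S _) (Σ⊆-split S _)) (sym (Σ⊆-+ (∁ S) _ _))

Σ⊆-support : ∀ {n} (S X : Subset n) {f : Subset n → ℕ} → X ⊆ S →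
             (∀ A → A ⊆ S → 0 < f A → A ⊆ X) → Σ⊆ S f ≡ Σ⊆ X f
Σ⊆-support [] [] _ _ = refl
Σ⊆-support (outside ∷ S) (outside ∷ X) X⊆S h =
  Σ⊆-support S X (drop-∷-⊆ X⊆S) (λ A A⊆S pos → drop-∷-⊆ (h _ (out⊆ A⊆S) pos))
Σ⊆-support (outside ∷ S) (inside ∷ X) X⊆S h with X⊆S here
... | ()
Σ⊆-support (inside ∷ S) (inside ∷ X) X⊆S h =
  cong₂ _+_ (Σ⊆-support S X (drop-∷-⊆ X⊆S) (λ A A⊆S pos → drop-∷-⊆ (h _ (out⊆ A⊆S) pos)))
            (Σ⊆-support S X (drop-∷-⊆ X⊆S) (λ A A⊆S pos → drop-∷-⊆ (h _ (in⊆in A⊆S) pos)))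
Σ⊆-support (inside ∷ S) (outside ∷ X) {f} X⊆S h =
  trans (cong₂ _+_ (Σ⊆-support S X (drop-∷-⊆ X⊆S) (λ A A⊆S pos → drop-∷-⊆ (h _ (out⊆ A⊆S) pos)))
                   (Σ⊆-zero S vanishes))
        (+-identityʳ _)
  where
  -- no set containing the first point lies in outside ∷ X
  vanishes : ∀ A → A ⊆ S → f (inside ∷ A) ≡ 0
  vanishes A A⊆S with f (inside ∷ A) | h (inside ∷ A) (in⊆in A⊆S)
  ... | zero | _ = refl
  ... | suc _ | support with support (s≤s z≤n) here
  ...   | ()

-- binomialSum r φ = Σ_k C(r,k) φ(k), computed by Pascal's rule.
binomialSum : ℕ → (ℕ → ℕ) → ℕ
binomialSum zero φ = φ 0
binomialSum (suc r) φ = binomialSum r φ + binomialSum r (λ k → φ (suc k))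

Σ⊆-card : ∀ {n} (X : Subset n) (φ : ℕ → ℕ) → Σ⊆ X (λ A → φ ∣ A ∣) ≡ binomialSum ∣ X ∣ φ
Σ⊆-card [] φ = refl
Σ⊆-card (outside ∷ X) φ = Σ⊆-card X φ
Σ⊆-card (inside ∷ X) φ = cong₂ _+_ (Σ⊆-card X φ) (Σ⊆-card X (λ k → φ (suc k)))

binomialSum-const : ∀ r c → binomialSum r (λ _ → c) ≡ 2 ^ r * c
binomialSum-const zero c = sym (*-identityˡ c)
binomialSum-const (suc r) c =
  trans (cong₂ _+_ (binomialSum-const r c) (binomialSum-const r c)) (double (2 ^ r) c)
  where
  double : ∀ x c → x * c + x * c ≡ 2 * x * c
  double = solve-∀

atMostOne : ℕ → ℕ
atMostOne 0 = 1
atMostOne 1 = 1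
atMostOne (suc (suc _)) = 0

atMostOne-small : ∀ {k} → k ≤ 1 → atMostOne k ≡ 1
atMostOne-small z≤n = refl
atMostOne-small (s≤s z≤n) = refl

atMostOne-large : ∀ {k} → 1 < k → atMostOne k ≡ 0
atMostOne-large (s≤s (s≤s _)) = refl

binomialSum-atMostOne : ∀ r → binomialSum r atMostOne ≡ suc r
binomialSum-atMostOne zero = refl
binomialSum-atMostOne (suc r) =
  trans (cong₂ _+_ (binomialSum-atMostOne r) (isZero r)) (+-comm (suc r) 1)
  where
  isZero : ∀ r → binomialSum r (λ k → atMostOne (suc k)) ≡ 1
  isZero zero = refl
  isZero (suc r) = cong₂ _+_ (isZero r) (trans (binomialSum-const r 0) (*-zeroʳ (2 ^ r)))

length-filter : ∀ {A : Set} (q : A → Bool) (xs : List A) →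
                length (filter (λ x → q x Data.Bool.≟ true) xs) ≡ sum (map (λ x → ind (q x)) xs)
length-filter q [] = refl
length-filter q (x ∷ xs) with q x
... | true = cong suc (length-filter q xs)
... | false = length-filter q xs

sum-allSubsets : ∀ n (h : Subset n → ℕ) → sum (map h (allSubsets n)) ≡ Σ⊆ ⊤ h
sum-allSubsets zero h = +-identityʳ (h [])
sum-allSubsets (suc n) h = begin
  sum (map h (map (outside ∷_) L ++ map (inside ∷_) L))
    ≡⟨ cong sum (map-++ h (map (outside ∷_) L) _) ⟩
  sum (map h (map (outside ∷_) L) ++ map h (map (inside ∷_) L))
    ≡⟨ sum-++ (map h (map (outside ∷_) L)) _ ⟩
  sum (map h (map (outside ∷_) L)) + sum (map h (map (inside ∷_) L))
    ≡⟨ cong₂ _+_ (cong sum (sym (map-∘ L))) (cong sum (sym (map-∘ L))) ⟩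
  sum (map (λ A → h (outside ∷ A)) L) + sum (map (λ A → h (inside ∷ A)) L)
    ≡⟨ cong₂ _+_ (sum-allSubsets n _) (sum-allSubsets n _) ⟩
  Σ⊆ ⊤ h ∎
  where
  open ≡-Reasoning
  L = allSubsets n

∈-allSubsets : ∀ {n} (T : Subset n) → T List.∈ allSubsets n
∈-allSubsets [] = Any.here refl
∈-allSubsets (outside ∷ T) = ∈-++⁺ˡ (∈-map⁺ (outside ∷_) (∈-allSubsets T))
∈-allSubsets (inside ∷ T) = ∈-++⁺ʳ (map (outside ∷_) (allSubsets _)) (∈-map⁺ (inside ∷_) (∈-allSubsets T))

maxCard : ∀ {n} → List (Subset n) → ℕ
maxCard = foldr (λ S m → ∣ S ∣ ⊔ m) 0

maxCard-upper : ∀ {n} {T : Subset n} (xs : List (Subset n)) → T List.∈ xs → ∣ T ∣ ≤ maxCard xs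
maxCard-upper (S ∷ xs) (Any.here refl) = m≤m⊔n ∣ S ∣ (maxCard xs)
maxCard-upper (S ∷ xs) (Any.there T∈) = ≤-trans (maxCard-upper xs T∈) (m≤n⊔m ∣ S ∣ (maxCard xs))

maxCard-attained : ∀ {n} {T₀ : Subset n} (xs : List (Subset n)) → T₀ List.∈ xs →
                   ∃[ T ] T List.∈ xs × ∣ T ∣ ≡ maxCard xs
maxCard-attained (S ∷ xs) _ = attained S xs
  where
  attained : ∀ {n} (S : Subset n) xs → ∃[ T ] T List.∈ (S ∷ xs) × ∣ T ∣ ≡ maxCard (S ∷ xs)
  attained S [] = S , Any.here refl , sym (⊔-identityʳ ∣ S ∣)
  attained S (S′ ∷ xs) with ⊔-sel ∣ S ∣ (maxCard (S′ ∷ xs)) | attained S′ xs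
  ... | inj₁ e | _ = S , Any.here refl , sym e
  ... | inj₂ e | T , T∈ , eT = T , Any.there T∈ , trans eT (sym e)

module _ {n : ℕ} (G : Graph n) where

  private
    stable? : (S : Subset n) → Dec (isStable G S ≡ true)
    stable? S = isStable G S Data.Bool.≟ true

  fibonacciIndex-Σ⊆ : fibonacciIndex G ≡ Σ⊆ (⊤ {n}) (λ T → ind (isStable G T))
  fibonacciIndex-Σ⊆ = trans (length-filter (isStable G) (allSubsets n)) (sum-allSubsets n _)

  Stable⇒≤α : ∀ T → Stable G T → ∣ T ∣ ≤ stabilityNumber G
  Stable⇒≤α T st = maxCard-upper (stableSets G) (∈-filter⁺ stable? (∈-allSubsets T) (Stable⇒isStable G T st))

  -- A maximum stable set exists (the empty set is stable, so the list is non-empty).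
  maximumStable : ∃[ S ] Stable G S × ∣ S ∣ ≡ stabilityNumber G
  maximumStable with maxCard-attained (stableSets G) (∈-filter⁺ stable? (∈-allSubsets ⊥) (Stable⇒isStable G ⊥ (Stable-⊥ G)))
  ... | S , S∈ , eS = S , isStable⇒Stable G S (proj₂ (∈-filter⁻ stable? {xs = allSubsets n} S∈)) , eS

completeAdj-≢ : ∀ {n} {u v : Fin n} → u ≢ v → completeAdj u v ≡ true
completeAdj-≢ {u = u} {v} u≢v with u Data.Fin.≟ v
... | yes u≡v = ⊥-elim (u≢v u≡v)
... | no _ = refl

module _ {n : ℕ} (G : Graph n) where

  Complete : Set
  Complete = ∀ u v → u ≢ v → adj G u v ≡ true

  Edgeless : Set
  Edgeless = ∀ u v → adj G u v ≡ false

  small⇒Stable : ∀ T → ∣ T ∣ ≤ 1 → Stable G T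
  small⇒Stable T small u∈T v∈T rewrite ∣∣≤1⇒≡ small u∈T v∈T = adj-irrefl G _

  Complete⇒small : Complete → ∀ T → Stable G T → ∣ T ∣ ≤ 1
  Complete⇒small complete T st with nonempty? T
  ... | no empty rewrite Empty-unique empty | ∣⊥∣≡0 n = z≤n
  ... | yes (u , u∈T) = ≤-trans (p⊆q⇒∣p∣≤∣q∣ T⊆⁅u⁆) (≤-reflexive (∣⁅x⁆∣≡1 u))
    where
    T⊆⁅u⁆ : T ⊆ ⁅ u ⁆
    T⊆⁅u⁆ {v} v∈T with v Data.Fin.≟ u
    ... | yes refl = x∈⁅x⁆ u
    ... | no v≢u with trans (sym (st v∈T u∈T)) (complete v u v≢u)
    ...   | ()

  1≤α : Fin n → 1 ≤ stabilityNumber G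
  1≤α u = begin
    1                     ≡⟨ sym (∣⁅x⁆∣≡1 u) ⟩
    ∣ ⁅ u ⁆ ∣             ≤⟨ ∣p∣≤∣p∪q∣ ⁅ u ⁆ ⁅ u ⁆ ⟩
    ∣ ⁅ u ⁆ ∪ ⁅ u ⁆ ∣     ≤⟨ Stable⇒≤α G _ (Stable-pair G (adj-irrefl G u)) ⟩
    stabilityNumber G ∎
    where open ≤-Reasoning

  α≡1⇒Complete : stabilityNumber G ≡ 1 → Complete
  α≡1⇒Complete α≡1 u v u≢v with adj G u v in e
  ... | true = refl
  ... | false = ⊥-elim (<-irrefl refl (begin-strict
    1                   <⟨ ≤-reflexive (sym (∣pair∣ u≢v)) ⟩
    ∣ ⁅ u ⁆ ∪ ⁅ v ⁆ ∣   ≤⟨ Stable⇒≤α G _ (Stable-pair G e) ⟩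
    stabilityNumber G   ≡⟨ α≡1 ⟩
    1 ∎))
    where open ≤-Reasoning

  Complete⇒α≡1 : Fin n → Complete → stabilityNumber G ≡ 1
  Complete⇒α≡1 u complete with maximumStable G
  ... | S , S-stable , ∣S∣≡α =
    ≤-antisym (subst (_≤ 1) ∣S∣≡α (Complete⇒small complete S S-stable)) (1≤α u)

  -- In a complete graph the stable sets are exactly the sets of size ≤ 1.
  Complete⇒F : Complete → fibonacciIndex G ≡ suc n
  Complete⇒F complete = begin
    fibonacciIndex G                          ≡⟨ fibonacciIndex-Σ⊆ G ⟩
    Σ⊆ (⊤ {n}) (λ T → ind (isStable G T))     ≡⟨ Σ⊆-cong (⊤ {n}) (λ T _ → indicator T) ⟩
    Σ⊆ (⊤ {n}) (λ T → atMostOne ∣ T ∣)        ≡⟨ Σ⊆-card (⊤ {n}) atMostOne ⟩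
    binomialSum ∣ ⊤ {n} ∣ atMostOne           ≡⟨ cong (λ k → binomialSum k atMostOne) (∣⊤∣≡n n) ⟩
    binomialSum n atMostOne                   ≡⟨ binomialSum-atMostOne n ⟩
    suc n ∎
    where
    open ≡-Reasoning
    indicator : ∀ T → ind (isStable G T) ≡ atMostOne ∣ T ∣
    indicator T with ∣ T ∣ ≤? 1
    ... | yes small rewrite Stable⇒isStable G T (small⇒Stable T small) = sym (atMostOne-small small)
    ... | no large rewrite ¬Stable⇒isStable-false G T (large ∘ Complete⇒small complete T) =
      sym (atMostOne-large (≰⇒> large))

  -- In an edgeless graph every set is stable, so α = n and F = 2^n.
  Edgeless⇒Stable : Edgeless → ∀ T → Stable G T
  Edgeless⇒Stable edgeless T {u} {v} _ _ = edgeless u v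

  Edgeless⇒α≡n : Edgeless → stabilityNumber G ≡ n
  Edgeless⇒α≡n edgeless with maximumStable G
  ... | S , _ , ∣S∣≡α = ≤-antisym (subst (_≤ n) ∣S∣≡α (∣p∣≤n S))
                                  (subst (_≤ stabilityNumber G) (∣⊤∣≡n n) (Stable⇒≤α G ⊤ (Edgeless⇒Stable edgeless ⊤)))

  Edgeless⇒F : Edgeless → fibonacciIndex G ≡ 2 ^ n
  Edgeless⇒F edgeless = begin
    fibonacciIndex G                  ≡⟨ fibonacciIndex-Σ⊆ G ⟩
    Σ⊆ (⊤ {n}) (λ T → ind (isStable G T)) ≡⟨ Σ⊆-cong (⊤ {n}) (λ T _ → cong ind (Stable⇒isStable G T (Edgeless⇒Stable edgeless T))) ⟩
    Σ⊆ (⊤ {n}) (λ T → 1)              ≡⟨ Σ⊆-card (⊤ {n}) (λ _ → 1) ⟩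
    binomialSum ∣ ⊤ {n} ∣ (λ _ → 1)   ≡⟨ cong (λ k → binomialSum k (λ _ → 1)) (∣⊤∣≡n n) ⟩
    binomialSum n (λ _ → 1)           ≡⟨ binomialSum-const n 1 ⟩
    2 ^ n * 1                         ≡⟨ *-identityʳ (2 ^ n) ⟩
    2 ^ n ∎
    where open ≡-Reasoning

  -- α = n forces the maximum stable set to be all of Fin n.
  α≡n⇒Edgeless : stabilityNumber G ≡ n → Edgeless
  α≡n⇒Edgeless α≡n u v with maximumStable G
  ... | S , S-stable , ∣S∣≡α = ⊤-stable ∈⊤ ∈⊤
    where
    ⊤-stable : Stable G ⊤
    ⊤-stable = subst (Stable G) (∣p∣≡n⇒p≡⊤ (trans ∣S∣≡α α≡n)) S-stable

  ≃K⇒Complete : G ≃G K n → Complete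
  ≃K⇒Complete (f , preserves) u v u≢v = trans (preserves u v) (completeAdj-≢ (λ fu≡fv → u≢v (injective fu≡fv)))
    where
    injective : Inverse.to f u ≡ Inverse.to f v → u ≡ v
    injective fu≡fv = trans (sym (Inverse.strictlyInverseʳ f u))
                            (trans (cong (Inverse.from f) fu≡fv) (Inverse.strictlyInverseʳ f v))

  Complete⇒≃K : Complete → G ≃G K n
  Complete⇒≃K complete = ↔-id (Fin n) , same
    where
    same : ∀ u v → adj G u v ≡ completeAdj u v
    same u v with u Data.Fin.≟ v
    ... | yes refl = adj-irrefl G u
    ... | no u≢v = complete u v u≢v

  Edgeless⇔≃Kbar : Edgeless ⇔ G ≃G Kbar n
  Edgeless⇔≃Kbar = mk⇔ (λ edgeless → ↔-id (Fin n) , edgeless) (λ (_ , preserves) → preserves)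

-- weight α k = 2^(α ∸ k) if k ≤ α, and 0 otherwise: the number of subsets of
-- an (α − k)-set, i.e. the most extensions a stable k-set can have inside a
-- maximum stable set of size α.
weight : ℕ → ℕ → ℕ
weight α zero = 2 ^ α
weight zero (suc k) = 0
weight (suc α) (suc k) = weight α k

weight-lower : ∀ x k α → x + k ≤ α → 2 ^ x ≤ weight α k
weight-lower x zero α x+0≤α = ^-monoʳ-≤ 2 (≤-trans (≤-reflexive (sym (+-identityʳ x))) x+0≤α)
weight-lower x (suc k) zero x+k<0 with ≤-trans (≤-reflexive (sym (+-suc x k))) x+k<0
... | ()
weight-lower x (suc k) (suc α) x+k<α = weight-lower x k α (≤-pred (≤-trans (≤-reflexive (sym (+-suc x k))) x+k<α))

weight-upper : ∀ α k → 2 ^ k * weight α k ≤ 2 ^ α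
weight-upper α zero = ≤-reflexive (*-identityˡ _)
weight-upper zero (suc k) = ≤-trans (≤-reflexive (*-zeroʳ (2 ^ suc k))) z≤n
weight-upper (suc α) (suc k) = ≤-trans (≤-reflexive (*-assoc 2 (2 ^ k) (weight α k))) (*-monoʳ-≤ 2 (weight-upper α k))

-- Counting stable sets by their trace outside a maximum stable set S:
-- a stable set is A ∪ B with A ⊆ S and B ⊆ ∁ S; for stable B, A must avoid
-- the neighbours of B, and those non-neighbours X satisfy ∣ X ∣ + ∣ B ∣ ≤ α.
module CountingBound {n : ℕ} (G : Graph n) (S : Subset n) (S-stable : Stable G S)
                     (∣S∣≡α : ∣ S ∣ ≡ stabilityNumber G) where

  private
    α = stabilityNumber G

  -- the number of stable sets meeting ∁ S exactly in B
  extensions : Subset n → ℕ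
  extensions B = Σ⊆ S (λ A → ind (isStable G (A ∪ B)))

  extensions-unstable : ∀ B → ¬ Stable G B → extensions B ≡ 0
  extensions-unstable B B-unstable = Σ⊆-zero S vanishes
    where
    vanishes : ∀ A → A ⊆ S → ind (isStable G (A ∪ B)) ≡ 0
    vanishes A _ with isStable G (A ∪ B) in st
    ... | false = refl
    ... | true = ⊥-elim (B-unstable (Stable-⊆ G (q⊆p∪q A B) (isStable⇒Stable G (A ∪ B) st)))

  nonNeighbours : Subset n → Subset n
  nonNeighbours B = tabulate (λ s → lookup S s ∧ allB (λ b → not (lookup B b ∧ adj G s b)))

  nonNeighbours⁻ : ∀ {B s} → s ∈ nonNeighbours B → s ∈ S × (∀ {b} → b ∈ B → adj G s b ≡ false)
  nonNeighbours⁻ {B} {s} s∈X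
    with lookup S s in s∈S | trans (sym (lookup∘tabulate _ s)) ([]=⇒lookup s∈X)
  ... | true | no-nbr = lookup⇒[]= s S s∈S , λ {b} b∈B → not-nbr b∈B (allB⁻ _ no-nbr b)
    where
    not-nbr : ∀ {b} → b ∈ B → not (lookup B b ∧ adj G s b) ≡ true → adj G s b ≡ false
    not-nbr b∈B h rewrite []=⇒lookup b∈B = trans (sym (not-involutive _)) (cong not h)

  nonNeighbours⁺ : ∀ {B s} → s ∈ S → (∀ {b} → b ∈ B → adj G s b ≡ false) → s ∈ nonNeighbours B
  nonNeighbours⁺ {B} {s} s∈S no-nbr = lookup⇒[]= s _ (begin
    lookup (nonNeighbours B) s                                      ≡⟨ lookup∘tabulate _ s ⟩
    lookup S s ∧ allB (λ b → not (lookup B b ∧ adj G s b))          ≡⟨ cong₂ _∧_ ([]=⇒lookup s∈S) (allB⁺ _ not-nbr) ⟩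
    true ∎)
    where
    open ≡-Reasoning
    not-nbr : ∀ b → not (lookup B b ∧ adj G s b) ≡ true
    not-nbr b with lookup B b in b∈B
    ... | false = refl
    ... | true rewrite no-nbr (lookup⇒[]= b B b∈B) = refl

  module _ {B : Subset n} (B⊆∁S : B ⊆ ∁ S) (B-stable : Stable G B) where

    private
      X = nonNeighbours B

    X⊆S : X ⊆ S
    X⊆S s∈X = proj₁ (nonNeighbours⁻ {B} s∈X)

    stable-extension⊆X : ∀ A → A ⊆ S → 0 < ind (isStable G (A ∪ B)) → A ⊆ X
    stable-extension⊆X A A⊆S pos {s} s∈A with isStable G (A ∪ B) in st
    ... | true = nonNeighbours⁺ (A⊆S s∈A) (λ b∈B → isStable⇒Stable G (A ∪ B) st (p⊆p∪q B s∈A) (q⊆p∪q A B b∈B))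

    X∪B-stable : Stable G (X ∪ B)
    X∪B-stable {u} {v} u∈ v∈ with x∈p∪q⁻ X B u∈ | x∈p∪q⁻ X B v∈
    ... | inj₁ u∈X | inj₁ v∈X = S-stable (X⊆S u∈X) (X⊆S v∈X)
    ... | inj₁ u∈X | inj₂ v∈B = proj₂ (nonNeighbours⁻ {B} u∈X) v∈B
    ... | inj₂ u∈B | inj₁ v∈X = trans (adj-sym G u v) (proj₂ (nonNeighbours⁻ {B} v∈X) u∈B)
    ... | inj₂ u∈B | inj₂ v∈B = B-stable u∈B v∈B

    -- X and B are disjoint since X ⊆ S and B ⊆ ∁ S
    ∣X∣+∣B∣≤α : ∣ X ∣ + ∣ B ∣ ≤ α
    ∣X∣+∣B∣≤α = begin
      ∣ X ∣ + ∣ B ∣ ≡⟨ sym (∣∪∣-disjoint X B (λ x∈X x∈B → x∈∁p⇒x∉p (B⊆∁S x∈B) (X⊆S x∈X))) ⟩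
      ∣ X ∪ B ∣     ≤⟨ Stable⇒≤α G (X ∪ B) X∪B-stable ⟩
      α ∎
      where open ≤-Reasoning

    -- the extensions of B are among the 2^∣X∣ subsets of X
    extensions-stable : extensions B ≤ weight α ∣ B ∣
    extensions-stable = begin
      extensions B                              ≡⟨ Σ⊆-support S X X⊆S stable-extension⊆X ⟩
      Σ⊆ X (λ A → ind (isStable G (A ∪ B)))     ≤⟨ Σ⊆-mono X (λ A _ → ind≤1 (isStable G (A ∪ B))) ⟩
      Σ⊆ X (λ _ → 1)                            ≡⟨ Σ⊆-card X (λ _ → 1) ⟩
      binomialSum (∣ X ∣) (λ _ → 1)             ≡⟨ trans (binomialSum-const (∣ X ∣) 1) (*-identityʳ _) ⟩
      2 ^ (∣ X ∣)                               ≤⟨ weight-lower (∣ X ∣) (∣ B ∣) α ∣X∣+∣B∣≤α ⟩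
      weight α ∣ B ∣ ∎
      where
      open ≤-Reasoning
      ind≤1 : ∀ b → ind b ≤ 1
      ind≤1 true = ≤-refl
      ind≤1 false = z≤n

  extensions-bound : ∀ B → B ⊆ ∁ S → extensions B ≤ weight α ∣ B ∣
  extensions-bound B B⊆∁S with isStable G B in st
  ... | true = extensions-stable B⊆∁S (isStable⇒Stable G B st)
  ... | false = ≤-trans (≤-reflexive (extensions-unstable B unstable)) z≤n
    where
    unstable : ¬ Stable G B
    unstable = HasEdge⇒¬Stable G (isStable-false⇒HasEdge G B st)

  fibonacciIndex-split : fibonacciIndex G ≡ Σ⊆ (∁ S) extensions
  fibonacciIndex-split = trans (fibonacciIndex-Σ⊆ G) (Σ⊆-split S _)

  ∣∁S∣≡n∸α : ∣ ∁ S ∣ ≡ n ∸ α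
  ∣∁S∣≡n∸α = trans (∣∁p∣≡n∸∣p∣ S) (cong (n ∸_) ∣S∣≡α)

  weightSum-card : Σ⊆ (∁ S) (λ B → weight α ∣ B ∣) ≡ binomialSum (n ∸ α) (weight α)
  weightSum-card = trans (Σ⊆-card (∁ S) (weight α)) (cong (λ r → binomialSum r (weight α)) ∣∁S∣≡n∸α)

  fibonacciIndex-bound : fibonacciIndex G ≤ binomialSum (n ∸ α) (weight α)
  fibonacciIndex-bound = begin
    fibonacciIndex G                       ≡⟨ fibonacciIndex-split ⟩
    Σ⊆ (∁ S) extensions                    ≤⟨ Σ⊆-mono (∁ S) extensions-bound ⟩
    Σ⊆ (∁ S) (λ B → weight α ∣ B ∣)        ≡⟨ weightSum-card ⟩
    binomialSum (n ∸ α) (weight α) ∎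
    where open ≤-Reasoning

  -- An edge outside S is a non-stable B of size 2 ≤ α, which loses its whole weight.
  fibonacciIndex-strict : 2 ≤ α → HasEdge G (∁ S) → fibonacciIndex G < binomialSum (n ∸ α) (weight α)
  fibonacciIndex-strict 2≤α (u , v , u∉S , v∉S , uv-edge) = begin-strict
    fibonacciIndex G                       ≡⟨ fibonacciIndex-split ⟩
    Σ⊆ (∁ S) extensions                    <⟨ Σ⊆-strict (∁ S) extensions-bound B₀ (pair⊆ u∉S v∉S) loses-weight ⟩
    Σ⊆ (∁ S) (λ B → weight α ∣ B ∣)        ≡⟨ weightSum-card ⟩
    binomialSum (n ∸ α) (weight α) ∎
    where
    open ≤-Reasoning
    B₀ = ⁅ u ⁆ ∪ ⁅ v ⁆
    u≢v : u ≢ v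
    u≢v refl with trans (sym uv-edge) (adj-irrefl G u)
    ... | ()
    B₀-edge : HasEdge G B₀
    B₀-edge = u , v , x∈p∪q⁺ (inj₁ (x∈⁅x⁆ u)) , x∈p∪q⁺ (inj₂ (x∈⁅x⁆ v)) , uv-edge
    loses-weight : extensions B₀ < weight α ∣ B₀ ∣
    loses-weight = begin-strict
      extensions B₀   ≡⟨ extensions-unstable B₀ (HasEdge⇒¬Stable G B₀-edge) ⟩
      0               <⟨ s≤s z≤n ⟩
      1               ≤⟨ weight-lower 0 (∣ B₀ ∣) α (≤-trans (≤-reflexive (∣pair∣ u≢v)) 2≤α) ⟩
      weight α ∣ B₀ ∣ ∎

  complement-HasEdge : α < n ∸ α → HasEdge G (∁ S)
  complement-HasEdge α<n∸α with isStable G (∁ S) in st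
  ... | false = isStable-false⇒HasEdge G (∁ S) st
  ... | true = ⊥-elim (<⇒≱ α<n∸α (subst (_≤ α) ∣∁S∣≡n∸α (Stable⇒≤α G (∁ S) (isStable⇒Stable G (∁ S) st))))

-- The right-hand side of the theorem, multiplied through by n − 1.
rhs : ℕ → ℕ → ℕ
rhs n α = (2 ^ n ∸ n ∸ 1) * (α ∸ 1) + (n + 1) * (n ∸ 1)

-- 2^n − n − 1 is a genuine (non-truncated) difference.
n<2^n : ∀ n → n < 2 ^ n
n<2^n zero = s≤s z≤n
n<2^n (suc n) = ≤-trans (+-mono-≤ (m^n>0 2 n) (n<2^n n)) (≤-reflexive (cong (2 ^ n +_) (sym (+-identityʳ (2 ^ n)))))

2^n∸n∸1+[n+1] : ∀ n → (2 ^ n ∸ n ∸ 1) + (n + 1) ≡ 2 ^ n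
2^n∸n∸1+[n+1] n = trans (cong (_+ (n + 1)) (∸-+-assoc (2 ^ n) n 1))
                        (m∸n+n≡m (subst (_≤ 2 ^ n) (+-comm 1 n) (n<2^n n)))

rhs-complete : ∀ n → rhs n 1 ≡ (n ∸ 1) * suc n
rhs-complete n = begin
  (2 ^ n ∸ n ∸ 1) * 0 + (n + 1) * (n ∸ 1) ≡⟨ cong (_+ (n + 1) * (n ∸ 1)) (*-zeroʳ (2 ^ n ∸ n ∸ 1)) ⟩
  (n + 1) * (n ∸ 1)                       ≡⟨ cong (_* (n ∸ 1)) (+-comm n 1) ⟩
  suc n * (n ∸ 1)                         ≡⟨ *-comm (suc n) (n ∸ 1) ⟩
  (n ∸ 1) * suc n ∎
  where open ≡-Reasoning

rhs-edgeless : ∀ n → rhs n n ≡ (n ∸ 1) * 2 ^ n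
rhs-edgeless n = begin
  (2 ^ n ∸ n ∸ 1) * (n ∸ 1) + (n + 1) * (n ∸ 1) ≡⟨ sym (*-distribʳ-+ (n ∸ 1) (2 ^ n ∸ n ∸ 1) (n + 1)) ⟩
  ((2 ^ n ∸ n ∸ 1) + (n + 1)) * (n ∸ 1)         ≡⟨ cong (_* (n ∸ 1)) (2^n∸n∸1+[n+1] n) ⟩
  2 ^ n * (n ∸ 1)                               ≡⟨ *-comm (2 ^ n) (n ∸ 1) ⟩
  (n ∸ 1) * 2 ^ n ∎
  where open ≡-Reasoning

rhs-lower : ∀ n α → α ≤ n → (α ∸ 1) * 2 ^ n ≤ rhs n α
rhs-lower n α α≤n = begin
  (α ∸ 1) * 2 ^ n                                   ≡⟨ cong ((α ∸ 1) *_) (sym (2^n∸n∸1+[n+1] n)) ⟩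
  (α ∸ 1) * ((2 ^ n ∸ n ∸ 1) + (n + 1))             ≡⟨ *-distribˡ-+ (α ∸ 1) (2 ^ n ∸ n ∸ 1) (n + 1) ⟩
  (α ∸ 1) * (2 ^ n ∸ n ∸ 1) + (α ∸ 1) * (n + 1)
    ≤⟨ +-mono-≤ (≤-reflexive (*-comm (α ∸ 1) _)) (*-monoˡ-≤ (n + 1) (∸-monoˡ-≤ 1 α≤n)) ⟩
  (2 ^ n ∸ n ∸ 1) * (α ∸ 1) + (n ∸ 1) * (n + 1)     ≡⟨ cong ((2 ^ n ∸ n ∸ 1) * (α ∸ 1) +_) (*-comm (n ∸ 1) (n + 1)) ⟩
  rhs n α ∎
  where open ≤-Reasoning

binomialSum-scale : ∀ r c φ → binomialSum r (λ k → c * φ k) ≡ c * binomialSum r φ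
binomialSum-scale zero c φ = refl
binomialSum-scale (suc r) c φ =
  trans (cong₂ _+_ (binomialSum-scale r c φ) (binomialSum-scale r c _)) (sym (*-distribˡ-+ c _ _))

-- If 2^k φ(k) ≤ K for all k then Σ_k C(r,k) φ(k) ≤ (3/2)^r K, since Σ_k C(r,k) 2^(−k) = (3/2)^r.
binomialSum-geometric : ∀ r (φ : ℕ → ℕ) K → (∀ k → 2 ^ k * φ k ≤ K) → 2 ^ r * binomialSum r φ ≤ 3 ^ r * K
binomialSum-geometric zero φ K bound = ≤-trans (bound 0) (≤-reflexive (sym (*-identityˡ K)))
binomialSum-geometric (suc r) φ K bound = begin
  2 ^ suc r * (binomialSum r φ + binomialSum r φ′)       ≡⟨ regroup (2 ^ r) (binomialSum r φ) (binomialSum r φ′) ⟩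
  2 * (2 ^ r * binomialSum r φ) + 2 ^ r * (2 * binomialSum r φ′)
    ≡⟨ cong (λ x → 2 * (2 ^ r * binomialSum r φ) + 2 ^ r * x) (sym (binomialSum-scale r 2 φ′)) ⟩
  2 * (2 ^ r * binomialSum r φ) + 2 ^ r * binomialSum r (λ k → 2 * φ′ k)
    ≤⟨ +-mono-≤ (*-monoʳ-≤ 2 (binomialSum-geometric r φ K bound)) (binomialSum-geometric r (λ k → 2 * φ′ k) K bound′) ⟩
  2 * (3 ^ r * K) + 3 ^ r * K                           ≡⟨ triple (3 ^ r) K ⟩
  3 ^ suc r * K ∎
  where
  open ≤-Reasoning
  φ′ : ℕ → ℕ
  φ′ k = φ (suc k)
  bound′ : ∀ k → 2 ^ k * (2 * φ′ k) ≤ K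
  bound′ k = subst (_≤ K) (shift (2 ^ k) (φ′ k)) (bound (suc k))
    where
    shift : ∀ x y → 2 * x * y ≡ x * (2 * y)
    shift = solve-∀
  regroup : ∀ x a b → 2 * x * (a + b) ≡ 2 * (x * a) + x * (2 * b)
  regroup = solve-∀
  triple : ∀ x K → 2 * (x * K) + x * K ≡ 3 * x * K
  triple = solve-∀

-- every m p holds iff p 0, …, p (m − 1) all hold; used for finite checks by evaluation.
every : ℕ → (ℕ → Bool) → Bool
every zero p = true
every (suc m) p = every m p ∧ p m

every-sound : ∀ m p → T (every m p) → ∀ {k} → k < m → T (p k)
every-sound (suc m) p h k<1+m with Equivalence.to T-∧ h | m<1+n⇒m<n∨m≡n k<1+m
... | below , _ | inj₁ k<m = every-sound m p below k<m
... | _ , at-m | inj₂ refl = at-m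

growth : ∀ k → (9 + k) * 3 ^ (8 + k) < 4 ^ (8 + k)
growth zero = <ᵇ⇒< 59049 65536 _
growth (suc k) = begin-strict
  (10 + k) * (3 * x)   ≡⟨ reassoc (10 + k) x ⟩
  3 * (10 + k) * x     ≤⟨ *-monoˡ-≤ x (≤-trans (m≤m+n (3 * (10 + k)) (6 + k)) (≤-reflexive (sym (linear k)))) ⟩
  4 * (9 + k) * x      ≡⟨ *-assoc 4 (9 + k) x ⟩
  4 * ((9 + k) * x)    <⟨ *-monoʳ-< 4 (growth k) ⟩
  4 * 4 ^ (8 + k) ∎
  where
  open ≤-Reasoning
  x = 3 ^ (8 + k)
  reassoc : ∀ m x → m * (3 * x) ≡ 3 * m * x
  reassoc = solve-∀
  linear : ∀ k → 4 * (9 + k) ≡ 3 * (10 + k) + (6 + k)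
  linear = solve-∀

key-reduction : ∀ a r → r * 3 ^ r < a * (4 ^ r ∸ 3 ^ r) → (a + r) * 3 ^ r < a * 4 ^ r
key-reduction a r h = begin-strict
  (a + r) * 3 ^ r                  ≡⟨ *-distribʳ-+ (3 ^ r) a r ⟩
  a * 3 ^ r + r * 3 ^ r            <⟨ +-monoʳ-< (a * 3 ^ r) h ⟩
  a * 3 ^ r + a * (4 ^ r ∸ 3 ^ r)  ≡⟨ sym (*-distribˡ-+ a (3 ^ r) _) ⟩
  a * (3 ^ r + (4 ^ r ∸ 3 ^ r))    ≡⟨ cong (a *_) (m+[n∸m]≡n (^-monoˡ-≤ r (≤ᵇ⇒≤ 3 4 _))) ⟩
  a * 4 ^ r ∎
  where open ≤-Reasoning

-- The key inequality (a + r)·3^r < a·4^r for a, r ≥ 1 and a + r ≥ 9: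
-- for r ≤ 7 it is checked at the least admissible a = 9 − r, for r ≥ 8 it is `growth`.
key : ∀ a r → 1 ≤ a → 1 ≤ r → 9 ≤ a + r → (a + r) * 3 ^ r < a * 4 ^ r
key a (suc i) 1≤a _ 9≤a+r with suc i Data.Nat.<? 8
... | yes r<8 = key-reduction a (suc i) (begin-strict
  suc i * 3 ^ suc i                       <⟨ <ᵇ⇒< _ _ (every-sound 7 checked table (≤-pred r<8)) ⟩
  (8 ∸ i) * (4 ^ suc i ∸ 3 ^ suc i)       ≤⟨ *-monoˡ-≤ _ (≤-trans (∸-monoˡ-≤ (suc i) 9≤a+r) (≤-reflexive (m+n∸n≡m a (suc i)))) ⟩
  a * (4 ^ suc i ∸ 3 ^ suc i) ∎)
  where
  open ≤-Reasoning
  checked : ℕ → Bool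
  checked i = suc i * 3 ^ suc i <ᵇ (8 ∸ i) * (4 ^ suc i ∸ 3 ^ suc i)
  table : T (every 7 checked)
  table = _
... | no r≮8 = key-reduction a (suc i) (begin-strict
  suc i * 3 ^ suc i       <⟨ m+n≤o⇒m≤o∸n (suc (suc i * 3 ^ suc i)) growth′ ⟩
  4 ^ suc i ∸ 3 ^ suc i   ≤⟨ m≤n*m _ a {{Data.Nat.>-nonZero 1≤a}} ⟩
  a * (4 ^ suc i ∸ 3 ^ suc i) ∎)
  where
  open ≤-Reasoning
  growth′ : suc i * 3 ^ suc i + 3 ^ suc i < 4 ^ suc i
  growth′ = ≤-trans (≤-reflexive (cong suc (+-comm (suc i * 3 ^ suc i) (3 ^ suc i))))
                    (subst (λ r → suc r * 3 ^ r < 4 ^ r) (m+[n∸m]≡n (≮⇒≥ r≮8)) (growth (suc i ∸ 8)))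

-- For n ≥ 10:  F ≤ Σ_k C(n−α,k) 2^(α−k) ≤ 2^α (3/2)^(n−α)  already gives
-- (n − 1)·F < (α − 1)·2^n, by the key inequality with a = α − 1, r = n − α.
large-order : ∀ n α F → 10 ≤ n → 2 ≤ α → α < n → F ≤ binomialSum (n ∸ α) (weight α) →
              (n ∸ 1) * F < (α ∸ 1) * 2 ^ n
large-order n α F 10≤n 2≤α α<n F≤B = *-cancelˡ-< (2 ^ r) _ _ (begin-strict
  2 ^ r * ((n ∸ 1) * F)           ≡⟨ swap (2 ^ r) (n ∸ 1) F ⟩
  (n ∸ 1) * (2 ^ r * F)           ≤⟨ *-monoʳ-≤ (n ∸ 1) geometric ⟩
  (n ∸ 1) * (3 ^ r * 2 ^ α)       ≡⟨ sym (*-assoc (n ∸ 1) (3 ^ r) (2 ^ α)) ⟩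
  (n ∸ 1) * 3 ^ r * 2 ^ α         <⟨ *-monoˡ-< (2 ^ α) {{m^n≢0 2 α}} key′ ⟩
  a * 4 ^ r * 2 ^ α               ≡⟨ powers ⟩
  2 ^ r * (a * 2 ^ n) ∎)
  where
  open ≤-Reasoning
  r = n ∸ α
  a = α ∸ 1
  α≤n = <⇒≤ α<n
  geometric : 2 ^ r * F ≤ 3 ^ r * 2 ^ α
  geometric = ≤-trans (*-monoʳ-≤ (2 ^ r) F≤B) (binomialSum-geometric r (weight α) (2 ^ α) (weight-upper α))
  a+r≡n∸1 : a + r ≡ n ∸ 1
  a+r≡n∸1 = trans (sym (+-∸-comm r (≤-trans (s≤s z≤n) 2≤α))) (cong (_∸ 1) (m+[n∸m]≡n α≤n))
  key′ : (n ∸ 1) * 3 ^ r < a * 4 ^ r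
  key′ = subst (λ m → m * 3 ^ r < a * 4 ^ r) a+r≡n∸1
           (key a r (∸-monoˡ-≤ 1 2≤α) (m<n⇒0<n∸m α<n) (subst (9 ≤_) (sym a+r≡n∸1) (∸-monoˡ-≤ 1 10≤n)))
  swap : ∀ x m y → x * (m * y) ≡ m * (x * y)
  swap = solve-∀
  powers : a * 4 ^ r * 2 ^ α ≡ 2 ^ r * (a * 2 ^ n)
  powers = begin-equality
    a * 4 ^ r * 2 ^ α               ≡⟨ cong (λ y → a * y * 2 ^ α) (4^r≡2^r*2^r r) ⟩
    a * (2 ^ r * 2 ^ r) * 2 ^ α     ≡⟨ regroup a (2 ^ r) (2 ^ α) ⟩
    2 ^ r * (a * (2 ^ r * 2 ^ α))   ≡⟨ cong (λ y → 2 ^ r * (a * y)) (sym (^-distribˡ-+-* 2 r α)) ⟩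
    2 ^ r * (a * 2 ^ (r + α))       ≡⟨ cong (λ m → 2 ^ r * (a * 2 ^ m)) (m∸n+n≡m α≤n) ⟩
    2 ^ r * (a * 2 ^ n) ∎
    where
    regroup : ∀ a x y → a * (x * x) * y ≡ x * (a * (x * y))
    regroup = solve-∀
    4^r≡2^r*2^r : ∀ r → 4 ^ r ≡ 2 ^ r * 2 ^ r
    4^r≡2^r*2^r zero = refl
    4^r≡2^r*2^r (suc r) = trans (cong (4 *_) (4^r≡2^r*2^r r)) (square (2 ^ r))
      where
      square : ∀ x → 4 * (x * x) ≡ 2 * x * (2 * x)
      square = solve-∀

-- The counting bound Σ_k C(n−α,k) 2^(α−k), lowered by one when α < n − α,
-- since then ∁ S is too large to be stable and must contain an edge.
countBound : ℕ → ℕ → ℕ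
countBound n α = binomialSum (n ∸ α) (weight α) ∸ ind (α <ᵇ n ∸ α)

≤countBound : ∀ n α F → F ≤ binomialSum (n ∸ α) (weight α) →
              (α < n ∸ α → F < binomialSum (n ∸ α) (weight α)) → F ≤ countBound n α
≤countBound n α F F≤B strict with α <ᵇ n ∸ α in lt
... | false = F≤B
... | true = ≤-trans (<⇒≤pred (strict (<ᵇ⇒< α (n ∸ α) (subst T (sym lt) _))))
                     (≤-reflexive (pred[m∸n]≡m∸[1+n] (binomialSum (n ∸ α) (weight α)) 0))

small-order : ∀ n α → 5 ≤ n → n < 10 → 2 ≤ α → α < n → (n ∸ 1) * countBound n α < rhs n α
small-order n α 5≤n n<10 2≤α α<n =
  <ᵇ⇒< _ _ (guarded (every-sound n (checked n) (every-sound 10 (λ m → every m (checked m)) table n<10) α<n)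
                    (Equivalence.from T-∧ (≤⇒≤ᵇ 5≤n , ≤⇒≤ᵇ 2≤α)))
  where
  checked : ℕ → ℕ → Bool
  checked n α = not ((5 ≤ᵇ n) ∧ (2 ≤ᵇ α)) ∨ ((n ∸ 1) * countBound n α <ᵇ rhs n α)
  table : T (every 10 (λ n → every n (checked n)))
  table = _
  guarded : ∀ {g e} → T (not g ∨ e) → T g → T e
  guarded {true} e _ = e

strict-bound : ∀ n α F → 5 ≤ n → 2 ≤ α → α < n → F ≤ binomialSum (n ∸ α) (weight α) →
               (α < n ∸ α → F < binomialSum (n ∸ α) (weight α)) → (n ∸ 1) * F < rhs n α
strict-bound n α F 5≤n 2≤α α<n F≤B strict with 10 ≤? n
... | yes 10≤n = <-≤-trans (large-order n α F 10≤n 2≤α α<n F≤B) (rhs-lower n α (<⇒≤ α<n))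
... | no n≱10 = ≤-<-trans (*-monoʳ-≤ (n ∸ 1) (≤countBound n α F F≤B strict))
                          (small-order n α 5≤n (≰⇒> n≱10) 2≤α α<n)

strict-or-extremal : ∀ n → 5 ≤ n → (G : Graph n) →
  (n ∸ 1) * fibonacciIndex G < rhs n (stabilityNumber G) ⊎ (G ≃G K n ⊎ G ≃G Kbar n)
strict-or-extremal n 5≤n G with maximumStable G
... | S , S-stable , ∣S∣≡α with stabilityNumber G ≤? 1 | stabilityNumber G Data.Nat.≟ n
...   | yes α≤1 | _ = inj₂ (inj₁ (Complete⇒≃K G (α≡1⇒Complete G (≤-antisym α≤1 (1≤α G (Data.Fin.fromℕ< 5≤n))))))
...   | no _ | yes α≡n = inj₂ (inj₂ (Equivalence.to (Edgeless⇔≃Kbar G) (α≡n⇒Edgeless G α≡n)))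
...   | no α≰1 | no α≢n = inj₁ (strict-bound n α (fibonacciIndex G) 5≤n 2≤α α<n
                                 fibonacciIndex-bound (λ α<n∸α → fibonacciIndex-strict 2≤α (complement-HasEdge α<n∸α)))
  where
  open CountingBound G S S-stable ∣S∣≡α
  α = stabilityNumber G
  2≤α = ≰⇒> α≰1
  α<n = ≤∧≢⇒< (subst (_≤ n) ∣S∣≡α (∣p∣≤n S)) α≢n

extremal-equality : ∀ n → Fin n → (G : Graph n) → G ≃G K n ⊎ G ≃G Kbar n →
  (n ∸ 1) * fibonacciIndex G ≡ rhs n (stabilityNumber G)
extremal-equality n u G (inj₁ G≃K) = begin
  (n ∸ 1) * fibonacciIndex G   ≡⟨ cong ((n ∸ 1) *_) (Complete⇒F G complete) ⟩
  (n ∸ 1) * suc n              ≡⟨ sym (rhs-complete n) ⟩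
  rhs n 1                      ≡⟨ cong (rhs n) (sym (Complete⇒α≡1 G u complete)) ⟩
  rhs n (stabilityNumber G) ∎
  where
  open ≡-Reasoning
  complete = ≃K⇒Complete G G≃K
extremal-equality n u G (inj₂ G≃Kbar) = begin
  (n ∸ 1) * fibonacciIndex G   ≡⟨ cong ((n ∸ 1) *_) (Edgeless⇒F G edgeless) ⟩
  (n ∸ 1) * 2 ^ n              ≡⟨ sym (rhs-edgeless n) ⟩
  rhs n n                      ≡⟨ cong (rhs n) (sym (Edgeless⇒α≡n G edgeless)) ⟩
  rhs n (stabilityNumber G) ∎
  where
  open ≡-Reasoning
  edgeless = Equivalence.from (Edgeless⇔≃Kbar G) G≃Kbar

lemma10 : (n : ℕ) → 5 ≤ n → (G : Graph n) →
    ((n ∸ 1) * fibonacciIndex G ≤ (2 ^ n ∸ n ∸ 1) * (stabilityNumber G ∸ 1) + (n + 1) * (n ∸ 1))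
    × (((n ∸ 1) * fibonacciIndex G ≡ (2 ^ n ∸ n ∸ 1) * (stabilityNumber G ∸ 1) + (n + 1) * (n ∸ 1))
    ⇔ (G ≃G K n ⊎ G ≃G Kbar n))
lemma10 n 5≤n G = inequality , mk⇔ equality⇒extremal (extremal-equality n (Data.Fin.fromℕ< 5≤n) G)
  where
  inequality : (n ∸ 1) * fibonacciIndex G ≤ rhs n (stabilityNumber G)
  inequality with strict-or-extremal n 5≤n G
  ... | inj₁ strict = <⇒≤ strict
  ... | inj₂ extremal = ≤-reflexive (extremal-equality n (Data.Fin.fromℕ< 5≤n) G extremal)
  equality⇒extremal : (n ∸ 1) * fibonacciIndex G ≡ rhs n (stabilityNumber G) → G ≃G K n ⊎ G ≃G Kbar n
  equality⇒extremal equal with strict-or-extremal n 5≤n G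
  ... | inj₁ strict = ⊥-elim (<-irrefl equal strict)
  ... | inj₂ extremal = extremal
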